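{- Let $2 \leq r \leq 4$. If $L = L_r ]_a^b C$, where $C$ is a finite chain and $(a,b)$ is an adjunct pair in $L_r$, then $\operatorname{Dim}(L) = 2$.
   Context: For $r \geq 1$, $L_r$ is the following lattice. Its elements are a chain $A_1 \prec x_1 \prec A_2 \prec x_2 \prec \cdots \prec A_{r-1} \prec x_{r-1} \prec A_r$ together with one element $c_{ij}$ for each pair $1 \leq i < j \leq r$; the chain elements are ordered as in the chain; for a chain element $z$, $z \leq c_{ij}$ iff $z \leq A_i$, and $c_{ij} \leq z$ iff $A_j \leq z$; and $c_{ij} < c_{kl}$ iff $j \leq k$. Its adjunct pairs are the pairs $(A_i, A_j)$, $1 \leq i<j\leq r$ (each $c_{ij}$ being adjoined as a singleton chain with respect to $(A_i,A_j)$). Adjunct sum: for disjoint lattices $L_1,L_2$ and $a<b$ in $L_1$ with $a \not\prec b$, $L_1 ]^b_a L_2$ is the set $L_1 \cup L_2$ with $x \leq y$ iff either $x,y\in L_1$ and $x\leq y$ in $L_1$; or $x,y\in L_2$ and $x\leq y$ in $L_2$; or $x\in L_1$, $y\in L_2$ and $x \leq a$ in $L_1$; or $x \in L_2$, $y \in L_1$ and $b \leq y$ in $L_1$. The dimension $\operatorname{Dim}(P)$ of a finite poset $P$ is the least number of linear extensions of its order whose intersection is exactly its order. -}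

module Defs where

open import Data.Nat using (ℕ; suc; _≤_; _<_; _*_; _+_)
open import Data.Fin using (Fin; toℕ)
import Data.Fin as F
open import Data.Sum using (_⊎_; inj₁; inj₂)
open import Data.Product using (Σ; _×_)
open import Relation.Binary.Core using (Rel)
open import Relation.Binary.Structures using (IsTotalOrder)
open import Relation.Binary.PropositionalEquality using (_≡_)
open import Relation.Nullary using (¬_)
open import Level using (0ℓ)

-- Elements of L_r (indices are 0-based: A i is A_{i+1}, x i is x_{i+1},
-- c i j is c_{i+1,j+1}).
data Lr (r : ℕ) : Set where
  A : Fin r → Lr r
  x : (i : Fin r) → suc (toℕ i) < r → Lr r
  c : (i j : Fin r) → toℕ i < toℕ j → Lr r

-- position in the chain A_1 < x_1 < A_2 < ... : A i ↦ 2i, x i ↦ 2i+1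
posA : ℕ → ℕ
posA i = 2 * i

posx : ℕ → ℕ
posx i = suc (2 * i)

_≤L_ : {r : ℕ} → Lr r → Lr r → Set
A i     ≤L A k     = posA (toℕ i) ≤ posA (toℕ k)
A i     ≤L x k _   = posA (toℕ i) ≤ posx (toℕ k)
x i _   ≤L A k     = posx (toℕ i) ≤ posA (toℕ k)
x i _   ≤L x k _   = posx (toℕ i) ≤ posx (toℕ k)
A p     ≤L c i j _ = posA (toℕ p) ≤ posA (toℕ i)
x p _   ≤L c i j _ = posx (toℕ p) ≤ posA (toℕ i)
c i j _ ≤L A p     = posA (toℕ j) ≤ posA (toℕ p)
c i j _ ≤L x p _   = posA (toℕ j) ≤ posx (toℕ p)
c i j _ ≤L c k l _ = (toℕ i ≡ toℕ k × toℕ j ≡ toℕ l) ⊎ toℕ j ≤ toℕ k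

_≤C_ : {n : ℕ} → Fin n → Fin n → Set
u ≤C v = u F.≤ v

AdjSum : {X Y : Set} → Rel X 0ℓ → Rel Y 0ℓ → X → X → Rel (X ⊎ Y) 0ℓ
AdjSum R₁ R₂ a b (inj₁ u) (inj₁ v) = R₁ u v
AdjSum R₁ R₂ a b (inj₂ u) (inj₂ v) = R₂ u v
AdjSum R₁ R₂ a b (inj₁ u) (inj₂ v) = R₁ u a
AdjSum R₁ R₂ a b (inj₂ u) (inj₁ v) = R₁ b v

IsLinExt : {X : Set} → Rel X 0ℓ → Rel X 0ℓ → Set
IsLinExt {X} R T = IsTotalOrder _≡_ T × (∀ (u v : X) → R u v → T u v)

Realizer : {X : Set} → Rel X 0ℓ → ℕ → Set₁
Realizer {X} R k =
  Σ (Fin k → Rel X 0ℓ) λ Ts →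
    (∀ t → IsLinExt R (Ts t)) × (∀ (u v : X) → (∀ t → Ts t u v) → R u v)

HasDim : {X : Set} → Rel X 0ℓ → ℕ → Set₁
HasDim R d = Realizer R d × (∀ k → k < d → ¬ Realizer R k)

-- The element c_ij is itself adjoined to L_r at (A_i, A_j): every other element lies
-- below c_ij iff it lies below A_i, and above c_ij iff it lies above A_j. So every element
-- except c_ij relates to the chain C exactly as it relates to c_ij, while c_ij and C are
-- incomparable; in particular L has no realizer with fewer than two linear extensions.
-- Conversely, given two linear extensions of L_r whose intersection is L_r, inserting C
-- just above c_ij in the first and just below c_ij in the second yields a realizer of L.
-- For r ≤ 4 such a pair exists, and is verified by exhaustive computation.

module Submission where

open import Defs
open import Data.Nat using (ℕ; suc; _≤_; _<_; _≤?_; _<?_; s≤s; s≤s⁻¹) renaming (_≟_ to _≟ℕ_)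
open import Data.Fin using (Fin; toℕ)
open import Data.Nat.Properties
  using (≤-refl; ≤-trans; ≤-total; ≤-antisym; ≤-irrelevant; <-≤-connex; ≤-<-trans; <-≤-trans; <⇒≤; <⇒≱;
         <-irrefl; ≤∧≢⇒<; *-cancelˡ-≤; *-monoʳ-≤; *-monoʳ-<)
import Data.Fin as Fin
open import Data.Fin.Patterns using (0F; 1F; 2F; 3F)
open import Data.Fin.Properties using (toℕ-injective; all?)
open import Data.List using (List; []; _∷_; length; findIndex)
open import Data.Maybe using (maybe′)
open import Data.Vec using (Vec; []; _∷_; lookup)
open import Data.Product using (Σ; _×_; _,_; proj₁; proj₂; uncurry)
open import Data.Sum using (_⊎_; inj₁; inj₂; swap)
open import Function using (_∘_)
open import Function.Bundles using (_⇔_; mk⇔; Equivalence)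
open import Function.Definitions using (Injective)
open import Relation.Binary.Core using (Rel)
open import Relation.Binary.Definitions using (DecidableEquality)
import Relation.Binary.Definitions as B
open import Relation.Binary.Structures using (IsTotalOrder)
open import Relation.Binary.PropositionalEquality using (_≡_; _≢_; refl; cong; subst; isEquivalence)
open import Relation.Nullary using (¬_; Dec; yes; no; Irrelevant; contradiction)
open import Relation.Nullary.Decidable using (True; toWitness; map′; _×-dec_; _⊎-dec_; _→-dec_)
open import Relation.Unary using (Pred)
import Relation.Unary as U
open import Level using (0ℓ)

open Equivalence using (to; from)

incomparable⇒¬Realizer<2 : {X : Set} {R : Rel X 0ℓ} {u v : X} → ¬ R u v → ¬ R v u →
                           ∀ k → k < 2 → ¬ Realizer R k
incomparable⇒¬Realizer<2 {u = u} {v} u≰v _ 0 _ (_ , _ , meet) = u≰v (meet u v λ ())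
incomparable⇒¬Realizer<2 {u = u} {v} u≰v v≰u 1 _ (_ , linExt , meet)
  with IsTotalOrder.total (proj₁ (linExt 0F)) u v
... | inj₁ u≤v = u≰v (meet u v λ { 0F → u≤v })
... | inj₂ v≤u = v≰u (meet v u λ { 0F → v≤u })
incomparable⇒¬Realizer<2 _ _ (suc (suc _)) (s≤s (s≤s ())) _

module ChainInsertion {X : Set} {n : ℕ} (label : X → ℕ) (cut : ℕ) where

  _⊑_ : Rel (X ⊎ Fin n) 0ℓ
  inj₁ u ⊑ inj₁ v = label u ≤ label v
  inj₁ u ⊑ inj₂ _ = label u < cut
  inj₂ _ ⊑ inj₁ v = cut ≤ label v
  inj₂ k ⊑ inj₂ l = toℕ k ≤ toℕ l

  isTotalOrder : Injective _≡_ _≡_ label → IsTotalOrder _≡_ _⊑_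
  isTotalOrder label-injective = record
    { isPartialOrder = record
      { isPreorder = record { isEquivalence = isEquivalence ; reflexive = reflexive ; trans = trans }
      ; antisym = antisym }
    ; total = total }
    where
    reflexive : ∀ {s t} → s ≡ t → s ⊑ t
    reflexive {inj₁ _} refl = ≤-refl
    reflexive {inj₂ _} refl = ≤-refl

    trans : ∀ {s t w} → s ⊑ t → t ⊑ w → s ⊑ w
    trans {inj₁ _} {inj₁ _} {inj₁ _} p q = ≤-trans p q
    trans {inj₁ _} {inj₁ _} {inj₂ _} p q = ≤-<-trans p q
    trans {inj₁ _} {inj₂ _} {inj₁ _} p q = <⇒≤ (<-≤-trans p q)
    trans {inj₁ _} {inj₂ _} {inj₂ _} p _ = p
    trans {inj₂ _} {inj₁ _} {inj₁ _} p q = ≤-trans p q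
    trans {inj₂ _} {inj₁ _} {inj₂ _} p q = contradiction p (<⇒≱ q)
    trans {inj₂ _} {inj₂ _} {inj₁ _} _ q = q
    trans {inj₂ _} {inj₂ _} {inj₂ _} p q = ≤-trans p q

    antisym : ∀ {s t} → s ⊑ t → t ⊑ s → s ≡ t
    antisym {inj₁ _} {inj₁ _} p q = cong inj₁ (label-injective (≤-antisym p q))
    antisym {inj₁ _} {inj₂ _} p q = contradiction q (<⇒≱ p)
    antisym {inj₂ _} {inj₁ _} p q = contradiction p (<⇒≱ q)
    antisym {inj₂ _} {inj₂ _} p q = cong inj₂ (toℕ-injective (≤-antisym p q))

    total : ∀ s t → s ⊑ t ⊎ t ⊑ s
    total (inj₁ u) (inj₁ v) = ≤-total (label u) (label v)
    total (inj₁ u) (inj₂ _) = <-≤-connex (label u) cut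
    total (inj₂ _) (inj₁ v) = swap (<-≤-connex (label v) cut)
    total (inj₂ k) (inj₂ l) = ≤-total (toℕ k) (toℕ l)

record IsLabelRealizer {X : Set} (R : Rel X 0ℓ) {k : ℕ} (label : Fin k → X → ℕ) : Set where
  field
    injective : ∀ t → Injective _≡_ _≡_ (label t)
    realizes  : ∀ u v → R u v ⇔ (∀ t → label t u ≤ label t v)

module _ {X : Set} {R : Rel X 0ℓ} {k : ℕ} {label : Fin (suc k) → X → ℕ}
         (realizer : IsLabelRealizer R label) where
  open IsLabelRealizer realizer

  adjSum-realizer : {a b : X} (cut : Fin (suc k) → ℕ) →
                    (∀ u → R u a ⇔ (∀ t → label t u < cut t)) →
                    (∀ v → R b v ⇔ (∀ t → cut t ≤ label t v)) →
                    (n : ℕ) → Realizer (AdjSum R (_≤C_ {n}) a b) (suc k)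
  adjSum-realizer {a} {b} cut below above n =
    order , (λ t → ChainInsertion.isTotalOrder (label t) (cut t) (injective t) , extends t) , meet
    where
    order : Fin (suc k) → Rel (X ⊎ Fin n) 0ℓ
    order t = ChainInsertion._⊑_ (label t) (cut t)

    extends : ∀ t s w → AdjSum R _≤C_ a b s w → order t s w
    extends t (inj₁ u) (inj₁ v) u≤v = to (realizes u v) u≤v t
    extends t (inj₁ u) (inj₂ _) u≤a = to (below u) u≤a t
    extends t (inj₂ _) (inj₁ v) b≤v = to (above v) b≤v t
    extends t (inj₂ _) (inj₂ _) k≤l = k≤l

    meet : ∀ s w → (∀ t → order t s w) → AdjSum R _≤C_ a b s w
    meet (inj₁ u) (inj₁ v) h = from (realizes u v) h
    meet (inj₁ u) (inj₂ _) h = from (below u) h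
    meet (inj₂ _) (inj₁ v) h = from (above v) h
    meet (inj₂ _) (inj₂ _) h = h 0F

record AdjoinedAt {X : Set} (R : Rel X 0ℓ) (a b e : X) : Set where
  field
    below : ∀ u → R u a ⇔ (R u e × u ≢ e)
    above : ∀ v → R b v ⇔ (R e v × e ≢ v)

module _ {X : Set} {R : Rel X 0ℓ} {k : ℕ} {label : Fin (suc (suc k)) → X → ℕ}
         (realizer : IsLabelRealizer R label) {a b e : X} (adjoined : AdjoinedAt R a b e) where
  open IsLabelRealizer realizer
  open AdjoinedAt adjoined

  label-< : ∀ {u v} → R u v → u ≢ v → ∀ t → label t u < label t v
  label-< {u} {v} u≤v u≢v t = ≤∧≢⇒< (to (realizes u v) u≤v t) (u≢v ∘ injective t)

  -- The chain is inserted just above e in the first extension and just below e in the others.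
  twinCut : Fin (suc (suc k)) → ℕ
  twinCut 0F          = suc (label 0F e)
  twinCut (Fin.suc t) = label (Fin.suc t) e

  below-twinCut : ∀ u → R u a ⇔ (∀ t → label t u < twinCut t)
  below-twinCut u = mk⇔ (λ u≤a → below→ (to (below u) u≤a)) (λ h → from (below u) (below← h))
    where
    below→ : R u e × u ≢ e → ∀ t → label t u < twinCut t
    below→ (u≤e , _)   0F          = s≤s (to (realizes u e) u≤e 0F)
    below→ (u≤e , u≢e) (Fin.suc t) = label-< u≤e u≢e (Fin.suc t)

    below← : (∀ t → label t u < twinCut t) → R u e × u ≢ e
    below← h = from (realizes u e) (λ { 0F → s≤s⁻¹ (h 0F) ; (Fin.suc t) → <⇒≤ (h (Fin.suc t)) })
             , λ { refl → <-irrefl refl (h 1F) }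

  above-twinCut : ∀ v → R b v ⇔ (∀ t → twinCut t ≤ label t v)
  above-twinCut v = mk⇔ (λ b≤v → above→ (to (above v) b≤v)) (λ h → from (above v) (above← h))
    where
    above→ : R e v × e ≢ v → ∀ t → twinCut t ≤ label t v
    above→ (e≤v , e≢v) 0F          = label-< e≤v e≢v 0F
    above→ (e≤v , _)   (Fin.suc t) = to (realizes e v) e≤v (Fin.suc t)

    above← : (∀ t → twinCut t ≤ label t v) → R e v × e ≢ v
    above← h = from (realizes e v) (λ { 0F → <⇒≤ (h 0F) ; (Fin.suc t) → h (Fin.suc t) })
             , λ { refl → <-irrefl refl (h 0F) }

adjSum-hasDim2 : {X : Set} {R : Rel X 0ℓ} {label : Fin 2 → X → ℕ} {a b e : X} →
                 IsLabelRealizer R label → AdjoinedAt R a b e →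
                 (n : ℕ) → HasDim (AdjSum R (_≤C_ {suc n}) a b) 2
adjSum-hasDim2 {e = e} realizer adjoined n =
  adjSum-realizer realizer (twinCut realizer adjoined)
    (below-twinCut realizer adjoined) (above-twinCut realizer adjoined) (suc n) ,
  incomparable⇒¬Realizer<2 {u = inj₁ e} {v = inj₂ 0F}
    (λ e≤a → proj₂ (to (below e) e≤a) refl) (λ b≤e → proj₂ (to (above e) b≤e) refl)
  where open AdjoinedAt adjoined

Exhaustible : Set → Set₁
Exhaustible X = {P : Pred X 0ℓ} → U.Decidable P → Dec (∀ u → P u)

∀-irrelevant? : {Q : Set} {P : Q → Set} → Irrelevant Q → Dec Q → (∀ q → Dec (P q)) → Dec (∀ q → P q)
∀-irrelevant? {P = P} irr (yes q) P? = map′ (λ p q′ → subst P (irr q q′) p) (λ h → h q) (P? q)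
∀-irrelevant? _ (no ¬q) _ = yes λ q → contradiction q ¬q

_⇔?_ : {P Q : Set} → Dec P → Dec Q → Dec (P ⇔ Q)
P? ⇔? Q? = map′ (uncurry mk⇔) (λ P⇔Q → to P⇔Q , from P⇔Q) ((P? →-dec Q?) ×-dec (Q? →-dec P?))

isLabelRealizer? : {X : Set} {R : Rel X 0ℓ} {k : ℕ} → Exhaustible X → DecidableEquality X →
                   B.Decidable R → (label : Fin k → X → ℕ) → Dec (IsLabelRealizer R label)
isLabelRealizer? ∀? _≟_ R? label =
  map′ (uncurry λ inj real → record { injective = inj ; realizes = real })
       (λ realizer → IsLabelRealizer.injective realizer , IsLabelRealizer.realizes realizer)
       (injective? ×-dec realizes?)
  where
  injective? = all? λ t → map′ (λ inj {u} {v} → inj u v) (λ inj u v → inj)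
                                (∀? λ u → ∀? λ v → (label t u ≟ℕ label t v) →-dec (u ≟ v))
  realizes? = ∀? λ u → ∀? λ v → R? u v ⇔? all? λ t → label t u ≤? label t v

x′ : ∀ {r} (i : Fin r) → {True (suc (toℕ i) <? r)} → Lr r
x′ i {i+1<r} = x i (toWitness i+1<r)

c′ : ∀ {r} (i j : Fin r) → {True (toℕ i <? toℕ j)} → Lr r
c′ i j {i<j} = c i j (toWitness i<j)

∀-Lr? : ∀ {r} → Exhaustible (Lr r)
∀-Lr? {r} {P} P? =
  map′ every (λ h → h ∘ A , (λ i → h ∘ x i) , λ i j → h ∘ c i j)
       (all? (P? ∘ A) ×-dec
        all? (λ i → ∀-irrelevant? ≤-irrelevant (suc (toℕ i) <? r) (P? ∘ x i)) ×-dec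
        all? λ i → all? λ j → ∀-irrelevant? ≤-irrelevant (toℕ i <? toℕ j) (P? ∘ c i j))
  where
  every : (∀ i → P (A i)) × (∀ i q → P (x i q)) × (∀ i j q → P (c i j q)) → ∀ u → P u
  every (hA , _  , _ ) (A i)     = hA i
  every (_  , hx , _ ) (x i q)   = hx i q
  every (_  , _  , hc) (c i j q) = hc i j q

_≟L_ : ∀ {r} → DecidableEquality (Lr r)
A i ≟L A k         = map′ (cong A) (λ { refl → refl }) (i Fin.≟ k)
x i p ≟L x k q     = map′ (λ { refl → cong (x i) (≤-irrelevant p q) }) (λ { refl → refl }) (i Fin.≟ k)
c i j p ≟L c k l q = map′ (λ { (refl , refl) → cong (c i j) (≤-irrelevant p q) }) (λ { refl → refl , refl })
                          (i Fin.≟ k ×-dec j Fin.≟ l)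
A _ ≟L x _ _       = no λ ()
A _ ≟L c _ _ _     = no λ ()
x _ _ ≟L A _       = no λ ()
x _ _ ≟L c _ _ _   = no λ ()
c _ _ _ ≟L A _     = no λ ()
c _ _ _ ≟L x _ _   = no λ ()

_≤L?_ : ∀ {r} → B.Decidable (_≤L_ {r})
A i     ≤L? A k      = posA (toℕ i) ≤? posA (toℕ k)
A i     ≤L? x k _    = posA (toℕ i) ≤? posx (toℕ k)
x i _   ≤L? A k      = posx (toℕ i) ≤? posA (toℕ k)
x i _   ≤L? x k _    = posx (toℕ i) ≤? posx (toℕ k)
A p     ≤L? c i _ _  = posA (toℕ p) ≤? posA (toℕ i)
x p _   ≤L? c i _ _  = posx (toℕ p) ≤? posA (toℕ i)
c _ j _ ≤L? A p      = posA (toℕ j) ≤? posA (toℕ p)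
c _ j _ ≤L? x p _    = posA (toℕ j) ≤? posx (toℕ p)
c i j _ ≤L? c k l _  = (toℕ i ≟ℕ toℕ k ×-dec toℕ j ≟ℕ toℕ l) ⊎-dec toℕ j ≤? toℕ k

c-cong : ∀ {r} {i j k l : Fin r} {p q} → toℕ i ≡ toℕ k → toℕ j ≡ toℕ l → c i j p ≡ c k l q
c-cong i≡k j≡l with toℕ-injective i≡k | toℕ-injective j≡l
... | refl | refl = cong (c _ _) (≤-irrelevant _ _)

c-adjoinedAt : ∀ {r} {i j : Fin r} (p : toℕ i < toℕ j) → AdjoinedAt _≤L_ (A i) (A j) (c i j p)
c-adjoinedAt {i = i} {j} p = record { below = below ; above = above }
  where
  j≰i : ¬ posA (toℕ j) ≤ posA (toℕ i)
  j≰i = <⇒≱ (*-monoʳ-< 2 p)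

  below : ∀ u → u ≤L A i ⇔ (u ≤L c i j p × u ≢ c i j p)
  below (A _)     = mk⇔ (_, λ ()) proj₁
  below (x _ _)   = mk⇔ (_, λ ()) proj₁
  below (c k l q) = mk⇔ (λ l≤i → inj₂ (*-cancelˡ-≤ 2 l≤i) , λ { refl → j≰i l≤i })
    λ { (inj₁ (k≡i , l≡j) , ≢c) → contradiction (c-cong k≡i l≡j) ≢c
      ; (inj₂ l≤i , _) → *-monoʳ-≤ 2 l≤i }

  above : ∀ v → A j ≤L v ⇔ (c i j p ≤L v × c i j p ≢ v)
  above (A _)     = mk⇔ (_, λ ()) proj₁
  above (x _ _)   = mk⇔ (_, λ ()) proj₁
  above (c k l q) = mk⇔ (λ j≤k → inj₂ (*-cancelˡ-≤ 2 j≤k) , λ { refl → j≰i j≤k })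
    λ { (inj₁ (i≡k , j≡l) , c≢) → contradiction (c-cong i≡k j≡l) c≢
      ; (inj₂ j≤k , _) → *-monoʳ-≤ 2 j≤k }

position : {X : Set} → DecidableEquality X → List X → X → ℕ
position _≟_ us u = maybe′ toℕ (length us) (findIndex (u ≟_) us)

fromExtensions : ∀ {r} (ws : Vec (List (Lr r)) 2) →
                 let label = position _≟L_ ∘ lookup ws in
                 {True (isLabelRealizer? ∀-Lr? _≟L_ _≤L?_ label)} →
                 Σ (Fin 2 → Lr r → ℕ) (IsLabelRealizer _≤L_)
fromExtensions ws {valid} = position _≟L_ ∘ lookup ws , toWitness valid

Lr-realizer : ∀ r → 2 ≤ r → r ≤ 4 → Σ (Fin 2 → Lr r → ℕ) (IsLabelRealizer _≤L_)
Lr-realizer 2 _ _ = fromExtensions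
  ((A 0F ∷ x′ 0F ∷ c′ 0F 1F ∷ A 1F ∷ []) ∷
   (A 0F ∷ c′ 0F 1F ∷ x′ 0F ∷ A 1F ∷ []) ∷ [])
Lr-realizer 3 _ _ = fromExtensions
  ((A 0F ∷ x′ 0F ∷ c′ 0F 1F ∷ A 1F ∷ x′ 1F ∷ c′ 1F 2F ∷ c′ 0F 2F ∷ A 2F ∷ []) ∷
   (A 0F ∷ c′ 0F 2F ∷ c′ 0F 1F ∷ x′ 0F ∷ A 1F ∷ c′ 1F 2F ∷ x′ 1F ∷ A 2F ∷ []) ∷ [])
Lr-realizer 4 _ _ = fromExtensions
  ((A 0F ∷ x′ 0F ∷ c′ 0F 1F ∷ A 1F ∷ c′ 1F 3F ∷ x′ 1F ∷ c′ 1F 2F ∷ c′ 0F 2F ∷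
    A 2F ∷ x′ 2F ∷ c′ 2F 3F ∷ c′ 0F 3F ∷ A 3F ∷ []) ∷
   (A 0F ∷ c′ 0F 3F ∷ c′ 0F 2F ∷ c′ 0F 1F ∷ x′ 0F ∷ A 1F ∷ c′ 1F 2F ∷ x′ 1F ∷
    A 2F ∷ c′ 2F 3F ∷ x′ 2F ∷ c′ 1F 3F ∷ A 3F ∷ []) ∷ [])
Lr-realizer 0 () _
Lr-realizer 1 (s≤s ()) _
Lr-realizer (suc (suc (suc (suc (suc _))))) _ (s≤s (s≤s (s≤s (s≤s ()))))

mainTheorem12 : (r : ℕ) → 2 ≤ r → r ≤ 4 →
    (i j : Fin r) → toℕ i < toℕ j →
    (m : ℕ) →
    HasDim (AdjSum (_≤L_ {r}) (_≤C_ {suc m}) (A i) (A j)) 2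
mainTheorem12 r 2≤r r≤4 i j i<j m =
  adjSum-hasDim2 (proj₂ (Lr-realizer r 2≤r r≤4)) (c-adjoinedAt i<j) m
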